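{- For every $n\ge 2$, the number $b_n$ of permutations of $[n]$ that contain at least one occurrence of the bi-vincular pattern $(123,\emptyset,\{0,1\})$ is $b_n=\frac12 (n-1)!\,(n-2)$.
   Context: A bi-vincular pattern of length $k$ is a triple $p=(\sigma,X,Y)$ with $\sigma$ a permutation of $[k]$ in one-line notation and $X,Y\subseteq\{0,1,\dots,k\}$. A permutation $\pi=\pi_1\cdots\pi_n$ of $[n]$ contains $p$ if there are indices $1\le i_1<\dots<i_k\le n$ such that $(\pi_{i_1},\dots,\pi_{i_k})$ is order-isomorphic to $\sigma$ and, writing $j_1<\dots<j_k$ for the set $\{\pi_{i_1},\dots,\pi_{i_k}\}$ in increasing order and setting $i_0=j_0=0$, $i_{k+1}=j_{k+1}=n+1$, we have $i_{x+1}=i_x+1$ for all $x\in X$ and $j_{y+1}=j_y+1$ for all $y\in Y$. Such an index tuple is an occurrence of $p$. -}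

module Defs where

open import Data.Nat using (ℕ; zero; suc; _+_; _*_; _∸_; _≤_)
open import Data.Fin using (Fin; toℕ; _<_)
open import Data.Vec using (Vec; lookup)
open import Data.List using (List; []; _∷_)
open import Data.List.Membership.Propositional using (_∈_)
open import Data.Product using (Σ; _×_; ∃; ∃-syntax; proj₁)
open import Data.Sum using (_⊎_)
open import Function.Bundles using (_⇔_)
open import Relation.Binary.PropositionalEquality using (_≡_)
open import Relation.Binary.Bundles using (Setoid)
import Relation.Binary.PropositionalEquality as P
import Relation.Binary.Construct.On as On

-- A permutation of [n] in one-line notation: π = π₁ ⋯ πₙ, stored as a
-- vector of length n with entries in Fin n (entry value v ∈ Fin n stands for
-- the number toℕ v + 1 ∈ [n]; position a ∈ Fin n stands for index toℕ a + 1).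
IsPerm : ∀ {n} → Vec (Fin n) n → Set
IsPerm {n} π = ∀ (a b : Fin n) → lookup π a ≡ lookup π b → a ≡ b

record BiVincular (k : ℕ) : Set where
  field
    σ     : Vec (Fin k) k
    σperm : IsPerm σ
    X     : List ℕ
    Y     : List ℕ
open BiVincular public

module _ {n k : ℕ} (π : Vec (Fin n) n) (p : BiVincular k)
         (i : Fin k → Fin n) where

  -- I m = i_m (1-based index), with i_0 = 0 and i_{k+1} = n+1.
  IdxRel : ℕ → ℕ → Set
  IdxRel m v = (m ≡ 0 × v ≡ 0)
             ⊎ (m ≡ suc k × v ≡ suc n)
             ⊎ (∃[ a ] (m ≡ suc (toℕ a) × v ≡ suc (toℕ (i a))))

  -- J m v : v = j_m, the m-th smallest of the chosen values (1-based),
  -- with j_0 = 0 and j_{k+1} = n+1.  The value of rank m is π_{i_a} where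
  -- σ_a = m (by order-isomorphism).
  ValRel : ℕ → ℕ → Set
  ValRel m v = (m ≡ 0 × v ≡ 0)
             ⊎ (m ≡ suc k × v ≡ suc n)
             ⊎ (∃[ a ] (m ≡ suc (toℕ (lookup (σ p) a))
                        × v ≡ suc (toℕ (lookup π (i a)))))

  IsOccurrence : Set
  IsOccurrence =
      (∀ (a b : Fin k) → a < b → i a < i b)
    × (∀ (a b : Fin k) → (lookup (σ p) a < lookup (σ p) b)
                           ⇔ (lookup π (i a) < lookup π (i b)))
    × (∀ x → x ∈ X p → ∀ u v → IdxRel x u → IdxRel (suc x) v → v ≡ suc u)
    × (∀ y → y ∈ Y p → ∀ u v → ValRel y u → ValRel (suc y) v → v ≡ suc u)

Contains : ∀ {n k} → Vec (Fin n) n → BiVincular k → Set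
Contains {n} {k} π p = ∃[ i ] IsOccurrence π p i

id3 : Vec (Fin 3) 3
id3 = Data.Vec.tabulate (λ a → a)
  where import Data.Vec

id3-perm : IsPerm id3
id3-perm a b e = P.subst₂ _≡_ (lk a) (lk b) e
  where
  import Data.Vec.Properties as VP
  lk : ∀ c → lookup id3 c ≡ c
  lk c = VP.lookup∘tabulate (λ a → a) c

p123 : BiVincular 3
p123 = record { σ = id3 ; σperm = id3-perm ; X = [] ; Y = 0 ∷ 1 ∷ [] }

ContainingSetoid : ℕ → ∀ {k} → BiVincular k → Setoid _ _
ContainingSetoid n p =
  On.setoid {B = Σ (Vec (Fin n) n) (λ π → IsPerm π × Contains π p)}
            (P.setoid (Vec (Fin n) n)) proj₁

module Submission where

-- Values of a permutation of [n] are stored as Fin n, so the value 1 of the paper is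
-- 0 here and the value 2 is 1.  The adjacency conditions Y = {0,1} force the smallest
-- value of an occurrence of (123, ∅, {0,1}) to be 1 and the middle one to be 2, so a
-- permutation contains the pattern iff the value 1 occurs before the value 2 and 2 is
-- not the last entry (the third entry of the occurrence can then be anything after 2).
--
-- A permutation of [M+1] is the same as its first entry x together with a permutation
-- w of [M], the tail being w with all values ≥ x moved up ("x ◃ w", via punchIn).
-- Splitting on x gives, for permutations where 1 is not last (innerZeroCount) and for
-- those where 1 precedes a non-last 2 (occurrenceCount), the recurrences
--   z(M+1) = M! + M·z(M)          (x = 1: any tail;  x > 1: 1 not last in the tail),
--   b(M+2) = z(M+1) + M·b(M+1)    (x = 1 / x = 2 / x > 2),
-- whence z(M+1) = M!·M and 2·b(M+1) = M!·(M-1).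

open import Defs
open import Data.Nat using (ℕ; _≤_; _*_; _∸_; _/_; _!)
open import Data.Fin using (Fin)
open import Function.Bundles using (Inverse)
open import Relation.Binary.PropositionalEquality using (setoid)

import Data.Nat as N
import Data.Nat.Properties as NP
import Data.Fin.Properties as FP
import Relation.Binary.Construct.On as On
open import Data.Nat using (zero; suc; _+_; z≤n; s≤s)
open import Data.Nat.DivMod using (m*n/n≡m)
open import Data.Nat.Tactic.RingSolver using (solve-∀)
open import Data.Fin using (toℕ; _<_; punchIn; punchOut; _↑ˡ_; _↑ʳ_; splitAt; join; combine; remQuot)
  renaming (zero to fz; suc to fs)
open import Data.Vec using (Vec; []; _∷_; lookup; map)
open import Data.Vec.Properties using (lookup-map)
open import Data.List using ([]; _∷_)
open import Data.List.Relation.Unary.Any using (here; there)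
open import Data.List.Membership.Propositional using (_∈_)
open import Data.Product using (Σ; _×_; _,_; proj₁; proj₂)
open import Data.Sum using (_⊎_; inj₁; inj₂)
open import Data.Unit using (⊤; tt)
open import Data.Empty using (⊥; ⊥-elim)
open import Function.Bundles using (_⇔_; mk⇔)
open import Relation.Binary.Definitions using (tri<; tri≈; tri>)
open import Relation.Binary.PropositionalEquality
  using (_≡_; refl; sym; trans; cong; cong₂; subst; _≢_; module ≡-Reasoning)

Whole : (A : Set) → A → Set
Whole A _ = ⊤

-- A bijection between the subsets P of A and Q of B.  Membership proofs need not be
-- unique, so both maps must ignore them; elements are compared with ≡ in A and B.
record _≋_ {A B : Set} (P : A → Set) (Q : B → Set) : Set where
  field
    to       : (a : A) → P a → B
    to-∈     : ∀ a p → Q (to a p)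
    from     : (b : B) → Q b → A
    from-∈   : ∀ b q → P (from b q)
    to-irr   : ∀ a p p' → to a p ≡ to a p'
    from-irr : ∀ b q q' → from b q ≡ from b q'
    from∘to  : ∀ a p → from (to a p) (to-∈ a p) ≡ a
    to∘from  : ∀ b q → to (from b q) (from-∈ b q) ≡ b

  to-cong : ∀ {a a'} p p' → a ≡ a' → to a p ≡ to a' p'
  to-cong p p' refl = to-irr _ p p'

  from-cong : ∀ {b b'} q q' → b ≡ b' → from b q ≡ from b' q'
  from-cong q q' refl = from-irr _ q q'

  from∘to′ : ∀ a p q → from (to a p) q ≡ a
  from∘to′ a p q = trans (from-irr _ q (to-∈ a p)) (from∘to a p)

  to∘from′ : ∀ b q p → to (from b q) p ≡ b
  to∘from′ b q p = trans (to-irr _ p (from-∈ b q)) (to∘from b q)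

open _≋_

_HasSize_ : {A : Set} → (A → Set) → ℕ → Set
P HasSize c = P ≋ Whole (Fin c)

≋-sym : ∀ {A B} {P : A → Set} {Q : B → Set} → P ≋ Q → Q ≋ P
≋-sym e = record
  { to = from e ; to-∈ = from-∈ e ; from = to e ; from-∈ = to-∈ e
  ; to-irr = from-irr e ; from-irr = to-irr e ; from∘to = to∘from e ; to∘from = from∘to e }

≋-trans : ∀ {A B C} {P : A → Set} {Q : B → Set} {R : C → Set} → P ≋ Q → Q ≋ R → P ≋ R
≋-trans e₁ e₂ = record
  { to       = λ a p → to e₂ (to e₁ a p) (to-∈ e₁ a p)
  ; to-∈     = λ a p → to-∈ e₂ _ _
  ; from     = λ c r → from e₁ (from e₂ c r) (from-∈ e₂ c r)
  ; from-∈   = λ c r → from-∈ e₁ _ _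
  ; to-irr   = λ a p p' → to-cong e₂ _ _ (to-irr e₁ a p p')
  ; from-irr = λ c r r' → from-cong e₁ _ _ (from-irr e₂ c r r')
  ; from∘to  = λ a p → trans (from-cong e₁ _ _ (from∘to′ e₂ _ _ _)) (from∘to e₁ a p)
  ; to∘from  = λ c r → trans (to-cong e₂ _ _ (to∘from′ e₁ _ _ _)) (to∘from e₂ c r)
  }

≋-iff : ∀ {A} {P Q : A → Set} → (∀ a → P a → Q a) → (∀ a → Q a → P a) → P ≋ Q
≋-iff pq qp = record
  { to = λ a _ → a ; to-∈ = pq ; from = λ b _ → b ; from-∈ = qp
  ; to-irr = λ _ _ _ → refl ; from-irr = λ _ _ _ → refl
  ; from∘to = λ _ _ → refl ; to∘from = λ _ _ → refl }

≋-empty : ∀ {A} {P : A → Set} → (∀ a → P a → ⊥) → P HasSize 0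
≋-empty np = record
  { to = λ a p → ⊥-elim (np a p) ; to-∈ = λ _ _ → tt ; from = λ () ; from-∈ = λ ()
  ; to-irr = λ a p _ → ⊥-elim (np a p) ; from-irr = λ ()
  ; from∘to = λ a p → ⊥-elim (np a p) ; to∘from = λ () }

HasSize-cast : ∀ {A} {P : A → Set} {c d} → c ≡ d → P HasSize c → P HasSize d
HasSize-cast refl e = e

module DisjointUnion {A : Set} {P Q : A → Set} {c d : ℕ}
         (e₁ : P HasSize c) (e₂ : Q HasSize d) (disjoint : ∀ a → P a → Q a → ⊥) where

  index : ∀ a → P a ⊎ Q a → Fin (c + d)
  index a (inj₁ p) = to e₁ a p ↑ˡ d
  index a (inj₂ q) = c ↑ʳ to e₂ a q

  element : Fin c ⊎ Fin d → A
  element (inj₁ j) = from e₁ j tt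
  element (inj₂ j) = from e₂ j tt

  element-∈ : ∀ s → P (element s) ⊎ Q (element s)
  element-∈ (inj₁ j) = inj₁ (from-∈ e₁ j tt)
  element-∈ (inj₂ j) = inj₂ (from-∈ e₂ j tt)

  index-irr : ∀ a p p' → index a p ≡ index a p'
  index-irr a (inj₁ p) (inj₁ p') = cong (_↑ˡ d) (to-irr e₁ a p p')
  index-irr a (inj₁ p) (inj₂ q)  = ⊥-elim (disjoint a p q)
  index-irr a (inj₂ q) (inj₁ p)  = ⊥-elim (disjoint a p q)
  index-irr a (inj₂ q) (inj₂ q') = cong (c ↑ʳ_) (to-irr e₂ a q q')

  element∘index : ∀ a p → element (splitAt c (index a p)) ≡ a
  element∘index a (inj₁ p) rewrite FP.splitAt-↑ˡ c (to e₁ a p) d = from∘to e₁ a p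
  element∘index a (inj₂ q) rewrite FP.splitAt-↑ʳ c d (to e₂ a q) = from∘to e₂ a q

  index∘element : ∀ s → index (element s) (element-∈ s) ≡ join c d s
  index∘element (inj₁ j) = cong (_↑ˡ d) (to∘from e₁ j tt)
  index∘element (inj₂ j) = cong (c ↑ʳ_) (to∘from e₂ j tt)

  ≋-union : (λ a → P a ⊎ Q a) HasSize (c + d)
  ≋-union = record
    { to = index ; to-∈ = λ _ _ → tt
    ; from = λ i _ → element (splitAt c i) ; from-∈ = λ i _ → element-∈ (splitAt c i)
    ; to-irr = index-irr ; from-irr = λ _ _ _ → refl
    ; from∘to = element∘index
    ; to∘from = λ i _ → trans (index∘element (splitAt c i)) (FP.join-splitAt c d i) }

open DisjointUnion using (≋-union)

≋-prod : ∀ {W : Set} {Q : W → Set} {c : ℕ} (j : ℕ) → Q HasSize c →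
         (λ (p : Fin j × W) → Q (proj₂ p)) HasSize (j * c)
≋-prod {W} {Q} {c} j e = record
  { to       = λ p q → combine (proj₁ p) (to e (proj₂ p) q)
  ; to-∈     = λ _ _ → tt
  ; from     = λ i _ → decode (remQuot c i)
  ; from-∈   = λ i _ → from-∈ e _ tt
  ; to-irr   = λ p q q' → cong (combine (proj₁ p)) (to-irr e _ q q')
  ; from-irr = λ _ _ _ → refl
  ; from∘to  = λ { (x , w) q →
      trans (cong decode (FP.remQuot-combine {j} {c} x (to e w q))) (cong (x ,_) (from∘to e w q)) }
  ; to∘from  = λ i _ →
      trans (cong (combine (proj₁ (remQuot {j} c i))) (to∘from e _ tt)) (FP.combine-remQuot {j} c i)
  }
  where
  decode : Fin j × Fin c → Fin j × W
  decode (x , k) = x , from e k tt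

≋-split : ∀ {M : ℕ} {W : Set} {c d : ℕ} (R : Fin (suc M) → W → Set) →
          (λ w → R fz w) HasSize c →
          (λ (p : Fin M × W) → R (fs (proj₁ p)) (proj₂ p)) HasSize d →
          (λ (p : Fin (suc M) × W) → R (proj₁ p) (proj₂ p)) HasSize (c + d)
≋-split {M} {W} R e₀ e₁ =
  ≋-trans (≋-iff {P = λ p → R (proj₁ p) (proj₂ p)} {Q = λ p → AtZero p ⊎ AtSuc p} cases uncases)
          (≋-union (≋-trans atZero e₀) (≋-trans atSuc e₁) disjoint)
  where
  AtZero : Fin (suc M) × W → Set
  AtZero p = proj₁ p ≡ fz × R fz (proj₂ p)

  AtSuc : Fin (suc M) × W → Set
  AtSuc p = Σ (Fin M) (λ i → proj₁ p ≡ fs i × R (fs i) (proj₂ p))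

  cases : ∀ p → R (proj₁ p) (proj₂ p) → AtZero p ⊎ AtSuc p
  cases (fz , w)   r = inj₁ (refl , r)
  cases (fs i , w) r = inj₂ (i , refl , r)

  uncases : ∀ p → AtZero p ⊎ AtSuc p → R (proj₁ p) (proj₂ p)
  uncases (x , w) (inj₁ (refl , r))     = r
  uncases (x , w) (inj₂ (i , refl , r)) = r

  disjoint : ∀ p → AtZero p → AtSuc p → ⊥
  disjoint (x , w) (refl , _) (i , () , _)

  atZero : AtZero ≋ (λ w → R fz w)
  atZero = record
    { to = λ p _ → proj₂ p ; to-∈ = λ p q → proj₂ q
    ; from = λ w _ → fz , w ; from-∈ = λ w r → refl , r
    ; to-irr = λ _ _ _ → refl ; from-irr = λ _ _ _ → refl
    ; from∘to = λ { (x , w) (refl , _) → refl } ; to∘from = λ _ _ → refl }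

  atSuc : AtSuc ≋ (λ (p : Fin M × W) → R (fs (proj₁ p)) (proj₂ p))
  atSuc = record
    { to = λ p q → proj₁ q , proj₂ p ; to-∈ = λ { p (i , refl , r) → r }
    ; from = λ p _ → fs (proj₁ p) , proj₂ p ; from-∈ = λ p r → proj₁ p , refl , r
    ; to-irr = λ { (x , w) (i , refl , _) (i' , e , _) → cong (_, w) (FP.suc-injective e) }
    ; from-irr = λ _ _ _ → refl
    ; from∘to = λ { (x , w) (i , refl , _) → refl } ; to∘from = λ _ _ → refl }

toInverse : ∀ {A : Set} {P : A → Set} {N : ℕ} → Whole (Fin N) ≋ P →
  Inverse (setoid (Fin N)) (On.setoid {B = Σ A P} (setoid A) proj₁)
toInverse e = record
  { to        = λ i → to e i tt , to-∈ e i tt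
  ; from      = λ s → from e (proj₁ s) (proj₂ s)
  ; to-cong   = λ { refl → refl }
  ; from-cong = λ {s} {t} eq → from-cong e (proj₂ s) (proj₂ t) eq
  ; inverse   = (λ { {x} refl → to∘from e (proj₁ x) (proj₂ x) })
              , (λ { {x} {y} eq → trans (from-cong e (proj₂ y) (to-∈ e x tt) eq) (from∘to e x tt) })
  }

Inj : ∀ {k m} → Vec (Fin m) k → Set
Inj {k} v = ∀ (a b : Fin k) → lookup v a ≡ lookup v b → a ≡ b

InjWith : ∀ {k m} → (Vec (Fin m) k → Set) → Vec (Fin m) k → Set
InjWith Q v = Inj v × Q v

_◃_ : ∀ {M K} → Fin (suc M) → Vec (Fin M) K → Vec (Fin (suc M)) (suc K)
x ◃ w = x ∷ map (punchIn x) w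

punchOutAll : ∀ {M k} (x : Fin (suc M)) (w : Vec (Fin (suc M)) k) → (∀ a → x ≢ lookup w a) →
              Vec (Fin M) k
punchOutAll x []      avoid = []
punchOutAll x (y ∷ w) avoid = punchOut (avoid fz) ∷ punchOutAll x w (λ a → avoid (fs a))

punchOutAll-irr : ∀ {M k} (x : Fin (suc M)) (w : Vec (Fin (suc M)) k) h h' →
                  punchOutAll x w h ≡ punchOutAll x w h'
punchOutAll-irr x []      h h' = refl
punchOutAll-irr x (y ∷ w) h h' = cong₂ _∷_ (FP.punchOut-cong x refl) (punchOutAll-irr x w _ _)

lookup-punchOutAll : ∀ {M k} (x : Fin (suc M)) (w : Vec (Fin (suc M)) k) h a →
                     lookup (punchOutAll x w h) a ≡ punchOut (h a)
lookup-punchOutAll x (y ∷ w) h fz     = refl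
lookup-punchOutAll x (y ∷ w) h (fs a) = lookup-punchOutAll x w _ a

punchIn∘punchOutAll : ∀ {M k} (x : Fin (suc M)) (w : Vec (Fin (suc M)) k) h →
                      map (punchIn x) (punchOutAll x w h) ≡ w
punchIn∘punchOutAll x []      h = refl
punchIn∘punchOutAll x (y ∷ w) h = cong₂ _∷_ (FP.punchIn-punchOut (h fz)) (punchIn∘punchOutAll x w _)

punchOutAll∘punchIn : ∀ {M k} (x : Fin (suc M)) (u : Vec (Fin M) k) h →
                      punchOutAll x (map (punchIn x) u) h ≡ u
punchOutAll∘punchIn x []      h = refl
punchOutAll∘punchIn x (y ∷ u) h =
  cong₂ _∷_ (trans (FP.punchOut-cong x refl) (FP.punchOut-punchIn x)) (punchOutAll∘punchIn x u _)

◃-injective : ∀ {M K} (x : Fin (suc M)) (u : Vec (Fin M) K) → Inj u → Inj (x ◃ u)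
◃-injective x u inj fz     fz     e = refl
◃-injective x u inj fz     (fs b) e = ⊥-elim (FP.punchInᵢ≢i x (lookup u b) (sym (trans e (lookup-map b (punchIn x) u))))
◃-injective x u inj (fs a) fz     e = ⊥-elim (FP.punchInᵢ≢i x (lookup u a) (trans (sym (lookup-map a (punchIn x) u)) e))
◃-injective x u inj (fs a) (fs b) e = cong fs (inj a b (FP.punchIn-injective x _ _
  (trans (sym (lookup-map a (punchIn x) u)) (trans e (lookup-map b (punchIn x) u)))))

module RemoveHead {M K : ℕ} (Q : Vec (Fin (suc M)) (suc K) → Set) where

  Pairs : Fin (suc M) × Vec (Fin M) K → Set
  Pairs p = InjWith (λ w → Q (proj₁ p ◃ w)) (proj₂ p)

  avoids-head : ∀ (x : Fin (suc M)) (w : Vec (Fin (suc M)) K) → Inj (x ∷ w) → ∀ a → x ≢ lookup w a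
  avoids-head x w inj a e with inj fz (fs a) e
  ... | ()

  split : ∀ v → InjWith Q v → Fin (suc M) × Vec (Fin M) K
  split (x ∷ w) (inj , q) = x , punchOutAll x w (avoids-head x w inj)

  split-∈ : ∀ v p → Pairs (split v p)
  split-∈ (x ∷ w) (inj , q) = tail-inj , subst (λ z → Q (x ∷ z)) (sym (punchIn∘punchOutAll x w _)) q
    where
    avoid = avoids-head x w inj
    tail-inj : Inj (punchOutAll x w avoid)
    tail-inj a b e = FP.suc-injective (inj (fs a) (fs b)
      (FP.punchOut-injective (avoid a) (avoid b)
        (trans (sym (lookup-punchOutAll x w _ a)) (trans e (lookup-punchOutAll x w _ b)))))

  ≋-head : InjWith Q ≋ Pairs
  ≋-head = record
    { to = split ; to-∈ = split-∈
    ; from = λ p _ → proj₁ p ◃ proj₂ p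
    ; from-∈ = λ { (x , u) (inj , q) → ◃-injective x u inj , q }
    ; to-irr = λ { (x ∷ w) _ _ → cong (x ,_) (punchOutAll-irr x w _ _) }
    ; from-irr = λ _ _ _ → refl
    ; from∘to = λ { (x ∷ w) _ → cong (x ∷_) (punchIn∘punchOutAll x w _) }
    ; to∘from = λ { (x , u) _ → cong (x ,_) (punchOutAll∘punchIn x u _) } }

open RemoveHead using (≋-head)

count-by-head : ∀ {M K c d} (Q : Vec (Fin (suc M)) (suc K) → Set) →
  (λ w → InjWith (λ w → Q (fz ◃ w)) w) HasSize c →
  (λ (p : Fin M × Vec (Fin M) K) → InjWith (λ w → Q (fs (proj₁ p) ◃ w)) (proj₂ p)) HasSize d →
  InjWith Q HasSize (c + d)
count-by-head Q e₀ e₁ = ≋-trans (≋-head Q) (≋-split (λ x → InjWith (λ w → Q (x ◃ w))) e₀ e₁)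

-- Some entry other than the last one satisfies Q.
Inner : ∀ {A : Set} {k} → (A → Set) → Vec A k → Set
Inner Q []                = ⊥
Inner {k = suc k} Q (x ∷ v) = (Q x × 0 N.< k) ⊎ Inner Q v

Before : ∀ {A : Set} {k} → (A → Set) → (A → Set) → Vec A k → Set
Before P Q []      = ⊥
Before P Q (x ∷ v) = (P x × Inner Q v) ⊎ Before P Q v

Inner-map : ∀ {A B : Set} {k} {Q : B → Set} {Q' : A → Set} (f : A → B) (v : Vec A k) →
            (∀ x → Q (f x) → Q' x) → Inner Q (map f v) → Inner Q' v
Inner-map f (x ∷ v) h (inj₁ (q , k>0)) = inj₁ (h x q , k>0)
Inner-map f (x ∷ v) h (inj₂ i)         = inj₂ (Inner-map f v h i)

Inner-map⁻ : ∀ {A B : Set} {k} {Q : B → Set} {Q' : A → Set} (f : A → B) (v : Vec A k) →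
             (∀ x → Q' x → Q (f x)) → Inner Q' v → Inner Q (map f v)
Inner-map⁻ f (x ∷ v) h (inj₁ (q , k>0)) = inj₁ (h x q , k>0)
Inner-map⁻ f (x ∷ v) h (inj₂ i)         = inj₂ (Inner-map⁻ f v h i)

Before-map : ∀ {A B : Set} {k} {P Q : B → Set} {P' Q' : A → Set} (f : A → B) (v : Vec A k) →
             (∀ x → P (f x) → P' x) → (∀ x → Q (f x) → Q' x) → Before P Q (map f v) → Before P' Q' v
Before-map f (x ∷ v) hp hq (inj₁ (p , i)) = inj₁ (hp x p , Inner-map f v hq i)
Before-map f (x ∷ v) hp hq (inj₂ b)       = inj₂ (Before-map f v hp hq b)

Before-map⁻ : ∀ {A B : Set} {k} {P Q : B → Set} {P' Q' : A → Set} (f : A → B) (v : Vec A k) →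
              (∀ x → P' x → P (f x)) → (∀ x → Q' x → Q (f x)) → Before P' Q' v → Before P Q (map f v)
Before-map⁻ f (x ∷ v) hp hq (inj₁ (p , i)) = inj₁ (hp x p , Inner-map⁻ f v hq i)
Before-map⁻ f (x ∷ v) hp hq (inj₂ b)       = inj₂ (Before-map⁻ f v hp hq b)

Inner-⊥ : ∀ {A : Set} {k} (v : Vec A k) → Inner (λ _ → ⊥) v → ⊥
Inner-⊥ (x ∷ v) (inj₁ (() , _))
Inner-⊥ (x ∷ v) (inj₂ i) = Inner-⊥ v i

Before-⊥ˡ : ∀ {A : Set} {k} {Q : A → Set} (v : Vec A k) → Before (λ _ → ⊥) Q v → ⊥
Before-⊥ˡ (x ∷ v) (inj₁ (() , _))
Before-⊥ˡ (x ∷ v) (inj₂ b) = Before-⊥ˡ v b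

Before-⊥ʳ : ∀ {A : Set} {k} {P : A → Set} (v : Vec A k) → Before P (λ _ → ⊥) v → ⊥
Before-⊥ʳ (x ∷ v) (inj₁ (_ , i)) = Inner-⊥ v i
Before-⊥ʳ (x ∷ v) (inj₂ b)       = Before-⊥ʳ v b

BeforeAt : ∀ {A : Set} {k} → (A → Set) → (A → Set) → Vec A k → Set
BeforeAt {k = k} P Q v = Σ (Fin k) λ a → Σ (Fin k) λ b → Σ (Fin k) λ c →
  a < b × b < c × P (lookup v a) × Q (lookup v b)

Inner⇒positions : ∀ {A : Set} {k} {Q : A → Set} (v : Vec A k) → Inner Q v →
                  Σ (Fin k) λ b → Σ (Fin k) λ c → b < c × Q (lookup v b)
Inner⇒positions (x ∷ y ∷ v) (inj₁ (q , _)) = fz , fs fz , s≤s z≤n , q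
Inner⇒positions (x ∷ v) (inj₂ i) with Inner⇒positions v i
... | b , c , b<c , q = fs b , fs c , s≤s b<c , q

positions⇒Inner : ∀ {A : Set} {k} {Q : A → Set} (v : Vec A k) (b c : Fin k) → b < c →
                  Q (lookup v b) → Inner Q v
positions⇒Inner (x ∷ v) fz     (fs c) _         q = inj₁ (q , NP.≤-trans (s≤s z≤n) (FP.toℕ<n c))
positions⇒Inner (x ∷ v) (fs b) (fs c) (s≤s b<c) q = inj₂ (positions⇒Inner v b c b<c q)

Before⇒BeforeAt : ∀ {A : Set} {k} {P Q : A → Set} (v : Vec A k) → Before P Q v → BeforeAt P Q v
Before⇒BeforeAt (x ∷ v) (inj₁ (p , i)) with Inner⇒positions v i
... | b , c , b<c , q = fz , fs b , fs c , s≤s z≤n , s≤s b<c , p , q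
Before⇒BeforeAt (x ∷ v) (inj₂ o) with Before⇒BeforeAt v o
... | a , b , c , a<b , b<c , p , q = fs a , fs b , fs c , s≤s a<b , s≤s b<c , p , q

BeforeAt⇒Before : ∀ {A : Set} {k} {P Q : A → Set} (v : Vec A k) → BeforeAt P Q v → Before P Q v
BeforeAt⇒Before (x ∷ v) (fz , fs b , fs c , _ , s≤s b<c , p , q) = inj₁ (p , positions⇒Inner v b c b<c q)
BeforeAt⇒Before (x ∷ v) (fs a , fs b , fs c , s≤s a<b , s≤s b<c , p , q) =
  inj₂ (BeforeAt⇒Before v (a , b , c , a<b , b<c , p , q))

ValueIs : ∀ {m} → ℕ → Fin m → Set
ValueIs c x = toℕ x ≡ c

-- punchIn p fixes every value below p, so for c < p it takes the value c exactly at c …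
punchIn-below : ∀ {m c} (p : Fin (suc m)) (y : Fin m) → c N.< toℕ p →
                ValueIs c (punchIn p y) → ValueIs c y
punchIn-below             (fs p) fz     _           e = e
punchIn-below {c = zero}  (fs p) (fs y) _           ()
punchIn-below {c = suc c} (fs p) (fs y) (s≤s c<p) e =
  cong suc (punchIn-below p y c<p (NP.suc-injective e))

punchIn-below⁻ : ∀ {m c} (p : Fin (suc m)) (y : Fin m) → c N.< toℕ p →
                 ValueIs c y → ValueIs c (punchIn p y)
punchIn-below⁻             (fs p) fz     _           e = e
punchIn-below⁻ {c = zero}  (fs p) (fs y) _           ()
punchIn-below⁻ {c = suc c} (fs p) (fs y) (s≤s c<p) e =
  cong suc (punchIn-below⁻ p y c<p (NP.suc-injective e))

punchIn-misses : ∀ {m} (p : Fin (suc m)) (y : Fin m) → ValueIs (toℕ p) (punchIn p y) → ⊥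
punchIn-misses p y e = FP.punchInᵢ≢i p y (FP.toℕ-injective e)

-- There are M! permutations of [M]  (note (suc M)! = M! + M * M! definitionally).
count-perms : ∀ M → InjWith {M} {M} (Whole _) HasSize (M !)
count-perms zero = record
  { to = λ _ _ → fz ; to-∈ = λ _ _ → tt ; from = λ _ _ → [] ; from-∈ = λ _ _ → (λ ()) , tt
  ; to-irr = λ _ _ _ → refl ; from-irr = λ _ _ _ → refl
  ; from∘to = λ { [] _ → refl } ; to∘from = λ { fz _ → refl } }
count-perms (suc M) = count-by-head (Whole _) (count-perms M) (≋-prod M (count-perms M))

InnerZero : ∀ {M} → Vec (Fin M) M → Set
InnerZero = Inner (ValueIs 0)

innerZeroCount : ℕ → ℕ
innerZeroCount zero    = 0
innerZeroCount (suc K) = K ! * K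

innerZero-step : ∀ K → suc K ! + suc K * (K ! * K) ≡ suc K ! * suc K
innerZero-step K = lemma (K !) K
  where
  lemma : ∀ F K → suc K * F + suc K * (F * K) ≡ suc K * F * suc K
  lemma = solve-∀

InnerZero-shift : ∀ {M} (x : Fin (suc M)) (w : Vec (Fin (suc M)) (suc M)) →
  InjWith (λ w → InnerZero (fs x ◃ w)) w → InjWith InnerZero w
InnerZero-shift x w (inj , inj₁ (() , _))
InnerZero-shift x w (inj , inj₂ i) = inj , Inner-map _ w (λ y → punchIn-below (fs x) y (s≤s z≤n)) i

InnerZero-unshift : ∀ {M} (x : Fin (suc M)) (w : Vec (Fin (suc M)) (suc M)) →
  InjWith InnerZero w → InjWith (λ w → InnerZero (fs x ◃ w)) w
InnerZero-unshift x w (inj , i) = inj , inj₂ (Inner-map⁻ _ w (λ y → punchIn-below⁻ (fs x) y (s≤s z≤n)) i)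

-- First entry 1: every tail works (M!); first entry > 1: 1 not last in the tail.
count-innerZero : ∀ M → InjWith {M} {M} InnerZero HasSize (innerZeroCount M)
count-innerZero zero          = ≋-empty (λ { [] (_ , ()) })
count-innerZero (suc zero)    = ≋-empty (λ { (x ∷ []) (_ , inj₁ (_ , ())) ; (x ∷ []) (_ , inj₂ ()) })
count-innerZero (suc (suc K)) =
  HasSize-cast (innerZero-step K) (count-by-head InnerZero headOne (headLarger (count-innerZero (suc K))))
  where
  headOne : (λ w → InjWith (λ w → InnerZero (fz ◃ w)) w) HasSize (suc K !)
  headOne = ≋-trans (≋-iff (λ w p → proj₁ p , tt) (λ w p → proj₁ p , inj₁ (refl , s≤s z≤n)))
                    (count-perms (suc K))

  headLarger : InjWith InnerZero HasSize innerZeroCount (suc K) →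
               (λ (p : Fin (suc K) × _) → InjWith (λ w → InnerZero (fs (proj₁ p) ◃ w)) (proj₂ p))
               HasSize (suc K * innerZeroCount (suc K))
  headLarger tails = ≋-trans (≋-iff (λ p → InnerZero-shift (proj₁ p) (proj₂ p))
                                    (λ p → InnerZero-unshift (proj₁ p) (proj₂ p)))
                             (≋-prod (suc K) tails)

OneBeforeTwo : ∀ {M} → Vec (Fin M) M → Set
OneBeforeTwo = Before (ValueIs 0) (ValueIs 1)

occurrenceCount : ℕ → ℕ
occurrenceCount zero          = 0
occurrenceCount (suc zero)    = 0
occurrenceCount (suc (suc L)) = innerZeroCount (suc L) + L * occurrenceCount (suc L)

-- First entry 1: the tail must have 2 (now 1) not last; first entry 2: nothing can
-- precede it; first entry > 2: the condition passes to the tail unchanged.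
count-occurrence : ∀ M → InjWith {M} {M} OneBeforeTwo HasSize (occurrenceCount M)
count-occurrence zero          = ≋-empty (λ { [] (_ , ()) })
count-occurrence (suc zero)    = ≋-empty (λ { (x ∷ []) (_ , inj₁ (_ , ())) ; (x ∷ []) (_ , inj₂ ()) })
count-occurrence (suc (suc L)) =
  count-by-head OneBeforeTwo headOne
    (≋-split (λ x → InjWith (λ w → OneBeforeTwo (fs x ◃ w))) headTwo (headLarger (count-occurrence (suc L))))
  where
  headOne : (λ w → InjWith (λ w → OneBeforeTwo (fz ◃ w)) w) HasSize innerZeroCount (suc L)
  headOne = ≋-trans (≋-iff shift unshift) (count-innerZero (suc L))
    where
    shift : ∀ w → InjWith (λ w → OneBeforeTwo (fz ◃ w)) w → InjWith InnerZero w
    shift w (inj , inj₁ (_ , i)) = inj , Inner-map fs w (λ y → NP.suc-injective) i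
    shift w (inj , inj₂ b)       = ⊥-elim (Before-⊥ˡ w (Before-map fs w (λ y ()) (λ y q → q) b))
    unshift : ∀ w → InjWith InnerZero w → InjWith (λ w → OneBeforeTwo (fz ◃ w)) w
    unshift w (inj , i) = inj , inj₁ (refl , Inner-map⁻ fs w (λ y → cong suc) i)

  headTwo : (λ w → InjWith (λ w → OneBeforeTwo (fs fz ◃ w)) w) HasSize 0
  headTwo = ≋-empty λ
    { w (_ , inj₁ (() , _))
    ; w (_ , inj₂ b) → Before-⊥ʳ w (Before-map _ w (λ y p → p) (punchIn-misses (fs fz)) b) }

  headLarger : InjWith OneBeforeTwo HasSize occurrenceCount (suc L) →
               (λ (p : Fin L × _) → InjWith (λ w → OneBeforeTwo (fs (fs (proj₁ p)) ◃ w)) (proj₂ p))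
               HasSize (L * occurrenceCount (suc L))
  headLarger tails = ≋-trans (≋-iff shift unshift) (≋-prod L tails)
    where
    shift : ∀ p → InjWith (λ w → OneBeforeTwo (fs (fs (proj₁ p)) ◃ w)) (proj₂ p) → InjWith OneBeforeTwo (proj₂ p)
    shift (x , w) (inj , inj₁ (() , _))
    shift (x , w) (inj , inj₂ b) =
      inj , Before-map _ w (λ y → punchIn-below (fs (fs x)) y (s≤s z≤n))
                           (λ y → punchIn-below (fs (fs x)) y (s≤s (s≤s z≤n))) b
    unshift : ∀ p → InjWith OneBeforeTwo (proj₂ p) → InjWith (λ w → OneBeforeTwo (fs (fs (proj₁ p)) ◃ w)) (proj₂ p)
    unshift (x , w) (inj , b) =
      inj , inj₂ (Before-map⁻ _ w (λ y → punchIn-below⁻ (fs (fs x)) y (s≤s z≤n))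
                                  (λ y → punchIn-below⁻ (fs (fs x)) y (s≤s (s≤s z≤n))) b)

occurrence-step : ∀ F L B → 2 * B ≡ F * L →
                  2 * (F * suc L + suc L * B) ≡ (suc (suc L) * F) * suc L
occurrence-step F L B 2B≡FL = begin
  2 * (F * suc L + suc L * B)       ≡⟨ expand F L B ⟩
  2 * F * suc L + suc L * (2 * B)   ≡⟨ cong (λ t → 2 * F * suc L + suc L * t) 2B≡FL ⟩
  2 * F * suc L + suc L * (F * L)   ≡⟨ collect F L ⟩
  (suc (suc L) * F) * suc L         ∎
  where
  open ≡-Reasoning
  expand : ∀ F L B → 2 * (F * suc L + suc L * B) ≡ 2 * F * suc L + suc L * (2 * B)
  expand = solve-∀
  collect : ∀ F L → 2 * F * suc L + suc L * (F * L) ≡ (suc (suc L) * F) * suc L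
  collect = solve-∀

twice-occurrenceCount : ∀ M → 2 * occurrenceCount (suc M) ≡ M ! * (M ∸ 1)
twice-occurrenceCount zero          = refl
twice-occurrenceCount (suc zero)    = refl
twice-occurrenceCount (suc (suc L)) =
  occurrence-step (suc L !) L (occurrenceCount (suc (suc L))) (twice-occurrenceCount (suc L))

occurrenceCount-closed : ∀ m → ((suc (suc m) ∸ 1) ! * (suc (suc m) ∸ 2)) / 2 ≡ occurrenceCount (suc (suc m))
occurrenceCount-closed m = begin
  (suc m ! * m) / 2                    ≡⟨ cong (_/ 2) (sym (twice-occurrenceCount (suc m))) ⟩
  (2 * occurrenceCount (suc (suc m))) / 2 ≡⟨ cong (_/ 2) (NP.*-comm 2 (occurrenceCount (suc (suc m)))) ⟩
  (occurrenceCount (suc (suc m)) * 2) / 2 ≡⟨ m*n/n≡m (occurrenceCount (suc (suc m))) 2 ⟩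
  occurrenceCount (suc (suc m))        ∎
  where open ≡-Reasoning

id3-lookup : ∀ x → lookup id3 x ≡ x
id3-lookup fz           = refl
id3-lookup (fs fz)      = refl
id3-lookup (fs (fs fz)) = refl

increasing3 : (g : Fin 3 → ℕ) → g fz N.< g (fs fz) → g (fs fz) N.< g (fs (fs fz)) →
              ∀ x y → x < y → g x N.< g y
increasing3 g p q fz      (fs fz)      _ = p
increasing3 g p q fz      (fs (fs fz)) _ = NP.<-trans p q
increasing3 g p q (fs fz) (fs (fs fz)) _ = q
increasing3 g p q fz           fz           ()
increasing3 g p q (fs fz)      fz           ()
increasing3 g p q (fs fz)      (fs fz)      (s≤s ())
increasing3 g p q (fs (fs fz)) fz           ()
increasing3 g p q (fs (fs fz)) (fs fz)      (s≤s ())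
increasing3 g p q (fs (fs fz)) (fs (fs fz)) (s≤s (s≤s ()))

increasing-reflects : ∀ {k} (g : Fin k → ℕ) → (∀ x y → x < y → g x N.< g y) →
                      ∀ x y → g x N.< g y → x < y
increasing-reflects g mono x y lt with FP.<-cmp x y
... | tri< x<y _ _ = x<y
... | tri≈ _ refl _ = ⊥-elim (NP.<-irrefl refl lt)
... | tri> _ _ y<x = ⊥-elim (NP.<-asym lt (mono y x y<x))

≥2 : ∀ n → n ≢ 0 → n ≢ 1 → 2 N.≤ n
≥2 zero          n≢0 _   = ⊥-elim (n≢0 refl)
≥2 (suc zero)    _   n≢1 = ⊥-elim (n≢1 refl)
≥2 (suc (suc n)) _   _   = s≤s (s≤s z≤n)

module Characterisation {n : ℕ} (π : Vec (Fin n) n) where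

  occurrence⇒positions : Contains π p123 → BeforeAt (ValueIs 0) (ValueIs 1) π
  occurrence⇒positions (i , mono , _ , _ , adjacentValues) =
    i fz , i (fs fz) , i (fs (fs fz)) , mono fz (fs fz) (s≤s z≤n) , mono (fs fz) (fs (fs fz)) (s≤s (s≤s z≤n)) ,
    value0 , value1
    where
    -- Y = {0,1}: the values j₀ = 0, j₁ = π_{i₁}, j₂ = π_{i₂} are consecutive
    value0 : toℕ (lookup π (i fz)) ≡ 0
    value0 = NP.suc-injective (adjacentValues 0 (here refl) 0 _ (inj₁ (refl , refl)) (inj₂ (inj₂ (fz , refl , refl))))
    value1 : toℕ (lookup π (i (fs fz))) ≡ 1
    value1 = trans (NP.suc-injective (adjacentValues 1 (there (here refl)) _ _ (inj₂ (inj₂ (fz , refl , refl)))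
                                        (inj₂ (inj₂ (fs fz , refl , refl))))) (cong suc value0)

  module FromPositions (inj : Inj π) (a b c : Fin n) (a<b : a < b) (b<c : b < c)
                       (value0 : toℕ (lookup π a) ≡ 0) (value1 : toℕ (lookup π b) ≡ 1) where

    I : Fin 3 → Fin n
    I fz           = a
    I (fs fz)      = b
    I (fs (fs fz)) = c

    -- π_c is neither 0 nor 1, these values being taken at the other positions a, b ≠ c.
    value2 : 2 N.≤ toℕ (lookup π c)
    value2 = ≥2 _ (λ e → FP.<⇒≢ (NP.<-trans a<b b<c) (inj a c (FP.toℕ-injective (trans value0 (sym e)))))
                  (λ e → FP.<⇒≢ b<c (inj b c (FP.toℕ-injective (trans value1 (sym e)))))

    V : Fin 3 → ℕ
    V x = toℕ (lookup π (I x))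

    V-increasing : ∀ x y → x < y → V x N.< V y
    V-increasing = increasing3 V (zero<one value0 value1) (subst (N._< toℕ (lookup π c)) (sym value1) value2)
      where
      zero<one : ∀ {u v} → u ≡ 0 → v ≡ 1 → u N.< v
      zero<one refl refl = s≤s z≤n

    order-iso : ∀ x y → (lookup id3 x < lookup id3 y) ⇔ (lookup π (I x) < lookup π (I y))
    order-iso x y rewrite id3-lookup x | id3-lookup y =
      mk⇔ (V-increasing x y) (increasing-reflects V V-increasing x y)

    valueOfRank : ∀ (r : Fin 3) u → ValRel π p123 I (suc (toℕ r)) u → u ≡ suc (toℕ (lookup π (I r)))
    valueOfRank r u (inj₁ (() , _))
    valueOfRank r u (inj₂ (inj₁ (e , _))) = ⊥-elim (NP.<-irrefl (NP.suc-injective e) (FP.toℕ<n r))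
    valueOfRank r u (inj₂ (inj₂ (x , e , u≡))) with FP.toℕ-injective (trans (NP.suc-injective e) (cong toℕ (id3-lookup x)))
    ... | refl = u≡

    valueOfRank0 : ∀ u → ValRel π p123 I 0 u → u ≡ 0
    valueOfRank0 u (inj₁ (_ , e))            = e
    valueOfRank0 u (inj₂ (inj₁ (() , _)))
    valueOfRank0 u (inj₂ (inj₂ (_ , () , _)))

    adjacentValues : ∀ y → y ∈ (0 ∷ 1 ∷ []) → ∀ u v →
                     ValRel π p123 I y u → ValRel π p123 I (suc y) v → v ≡ suc u
    adjacentValues .0 (here refl) u v r s
      rewrite valueOfRank0 u r | valueOfRank fz v s = cong suc value0
    adjacentValues .1 (there (here refl)) u v r s
      rewrite valueOfRank fz u r | valueOfRank (fs fz) v s = cong suc (trans value1 (cong suc (sym value0)))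

    occurrence : Contains π p123
    occurrence = I , increasing3 (λ x → toℕ (I x)) a<b b<c , order-iso , (λ _ ()) , adjacentValues

  positions⇒occurrence : Inj π → BeforeAt (ValueIs 0) (ValueIs 1) π → Contains π p123
  positions⇒occurrence inj (a , b , c , a<b , b<c , v0 , v1) = FromPositions.occurrence inj a b c a<b b<c v0 v1

containing≋oneBeforeTwo : ∀ n →
  (λ (π : Vec (Fin n) n) → IsPerm π × Contains π p123) ≋ InjWith OneBeforeTwo
containing≋oneBeforeTwo n = ≋-iff
  (λ π p → proj₁ p , BeforeAt⇒Before π (occurrence⇒positions π (proj₂ p)))
  (λ π p → proj₁ p , positions⇒occurrence π (proj₁ p) (Before⇒BeforeAt π (proj₂ p)))
  where open Characterisation

mainTheorem12 : ∀ (n : ℕ) → 2 ≤ n →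
    Inverse (setoid (Fin (((n ∸ 1) ! * (n ∸ 2)) / 2))) (ContainingSetoid n p123)
mainTheorem12 (suc zero) (s≤s ())
mainTheorem12 (suc (suc m)) _ =
  toInverse (≋-sym (HasSize-cast (sym (occurrenceCount-closed m))
    (≋-trans (containing≋oneBeforeTwo (suc (suc m))) (count-occurrence (suc (suc m))))))
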